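{- Let $G$ be a graph and $\mathcal{H}$ a set of graphs, and suppose $G$ is critically $\mathcal{H}$-exist. Then for every $S\subseteq V(G)$ such that $G[S]$ is isomorphic to a graph in $\mathcal{H}$: (1) $V(G)\setminus S$ is an independent set, and (2) no vertex $x\in V(G)\setminus S$ satisfies $N[x]\subseteq N[y]$ for some $y\in S$.
   Context: All graphs are finite and simple; $N[x]=N(x)\cup\{x\}$ is the closed neighbourhood and $G[S]$ the induced subgraph. A graph is $\mathcal{H}$-free if none of its induced subgraphs is isomorphic to a graph in $\mathcal{H}$, and $\mathcal{H}$-exist otherwise. For an edge $e=uv$, the contraction $G/e$ is obtained by deleting $u,v$ and adding a new vertex adjacent to every vertex of $(N(u)\cup N(v))\setminus\{u,v\}$. $G$ is critically $\mathcal{H}$-exist if it is $\mathcal{H}$-exist and $G/e$ is $\mathcal{H}$-free for every $e\in E(G)$. -}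

module Defs where

open import Data.Nat using (ℕ; suc)
open import Data.Fin using (Fin; punchIn)
open import Data.Fin.Subset using (Subset; _∈_; _∉_)
open import Data.Product using (Σ; ∃; _×_; _,_)
open import Data.Sum using (_⊎_; inj₁; inj₂)
open import Data.Empty using (⊥)
open import Function using (_∘_)
open import Function.Definitions using (Injective)
open import Relation.Nullary using (¬_)
open import Relation.Binary.PropositionalEquality using (_≡_; _≢_; refl; sym)

record Graph : Set₁ where
  field
    n      : ℕ
    Adj    : Fin n → Fin n → Set
    adj-sym    : ∀ {x y} → Adj x y → Adj y x
    adj-irrefl : ∀ {x} → ¬ Adj x x
open Graph public

GraphClass : Set₁
GraphClass = Graph → Set

record InducedIso (G : Graph) (S : Subset (n G)) (H : Graph) : Set where
  field
    φ      : Fin (n H) → Fin (n G)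
    φ-inj  : Injective _≡_ _≡_ φ
    φ-into : ∀ i → φ i ∈ S
    φ-onto : ∀ x → x ∈ S → ∃ λ i → φ i ≡ x
    φ-adj  : ∀ i j → Adj H i j → Adj G (φ i) (φ j)
    φ-adj⁻ : ∀ i j → Adj G (φ i) (φ j) → Adj H i j

InducesMember : GraphClass → (G : Graph) → Subset (n G) → Set₁
InducesMember 𝓗 G S = Σ Graph λ H → 𝓗 H × InducedIso G S H

HExist : GraphClass → Graph → Set₁
HExist 𝓗 G = Σ (Subset (n G)) λ S → InducesMember 𝓗 G S

HFree : GraphClass → Graph → Set₁
HFree 𝓗 G = ¬ HExist 𝓗 G

-- The vertices of G/e are Fin m (where
-- n = suc m), identified with V(G) ∖ {v} via punchIn v; the vertex
-- corresponding to u is the new merged vertex.  A new vertex a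
-- "represents" the old vertex punchIn v a, and additionally v if
-- punchIn v a ≡ u.
module _ {m : ℕ} (Adj₀ : Fin (suc m) → Fin (suc m) → Set)
         (sym₀ : ∀ {x y} → Adj₀ x y → Adj₀ y x)
         (u v : Fin (suc m)) where

  Rep : Fin m → Fin (suc m) → Set
  Rep a x = x ≡ punchIn v a ⊎ (punchIn v a ≡ u × x ≡ v)

  CAdj : Fin m → Fin m → Set
  CAdj a b = a ≢ b × Σ (Fin (suc m)) λ x → Σ (Fin (suc m)) λ y →
               Rep a x × Rep b y × Adj₀ x y

  CAdj-sym : ∀ {a b} → CAdj a b → CAdj b a
  CAdj-sym (a≢b , x , y , rx , ry , e) =
    (λ eq → a≢b (sym eq)) , y , x , ry , rx , sym₀ e

  CAdj-irrefl : ∀ {a} → ¬ CAdj a a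
  CAdj-irrefl (a≢a , _) = a≢a refl

contractAux : (m : ℕ) (Adj₀ : Fin (suc m) → Fin (suc m) → Set)
  → (∀ {x y} → Adj₀ x y → Adj₀ y x) → Fin (suc m) → Fin (suc m) → Graph
contractAux m Adj₀ s u v = record
  { n = m
  ; Adj = CAdj Adj₀ s u v
  ; adj-sym = CAdj-sym Adj₀ s u v
  ; adj-irrefl = CAdj-irrefl Adj₀ s u v }

-- G / uv  (the adjacency proof forces n G to be a successor)
contract : (G : Graph) (u v : Fin (n G)) → Adj G u v → Graph
contract record { n = suc m ; Adj = A ; adj-sym = s } u v _ = contractAux m A s u v

CriticallyHExist : GraphClass → Graph → Set₁
CriticallyHExist 𝓗 G =
  HExist 𝓗 G × (∀ u v (e : Adj G u v) → HFree 𝓗 (contract G u v e))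

InClosedNbhd : (G : Graph) → Fin (n G) → Fin (n G) → Set
InClosedNbhd G x z = z ≡ x ⊎ Adj G x z

-- If v ∉ S, contracting an edge uv keeps a copy of G[S] alive as long as the
-- merged vertex u sees, inside S, nothing that it did not already see: the
-- contraction embeds V(G) ∖ {v} into G/uv, and if u ∉ S or N(v) ∩ S ⊆ N[u]
-- the adjacency between vertices of S is unchanged.  An edge outside S, or a
-- vertex x ∉ S with N[x] ⊆ N[y] for some y ∈ S (contract yx), would thus
-- leave G/e 𝓗-exist, contradicting criticality.
module Submission where

open import Defs
open import Data.Nat using (suc)
open import Data.Fin using (Fin; punchIn; punchOut)
open import Data.Fin.Properties using (punchIn-punchOut; punchIn-injective)
open import Data.Fin.Subset using (Subset; _∈_; _∉_)
open import Data.Vec using (lookup; tabulate)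
open import Data.Vec.Properties using ([]=⇒lookup; lookup⇒[]=; lookup∘tabulate)
open import Data.Product using (Σ; ∃; _×_; _,_; proj₁; proj₂)
open import Data.Sum using (_⊎_; inj₁; inj₂)
open import Data.Empty using (⊥-elim)
open import Function using (_∘_)
open import Function.Definitions using (Injective)
open import Relation.Nullary using (¬_)
open import Relation.Binary.PropositionalEquality
  using (_≡_; _≢_; refl; sym; trans; cong; subst; subst₂; ≢-sym)

preimage : ∀ {m k} → (Fin m → Fin k) → Subset k → Subset m
preimage ι S = tabulate (lookup S ∘ ι)

module _ {m k} {ι : Fin m → Fin k} {S : Subset k} where

  ∈-preimage⁺ : ∀ {a} → ι a ∈ S → a ∈ preimage ι S
  ∈-preimage⁺ {a} ιa∈S =
    lookup⇒[]= a (preimage ι S) (trans (lookup∘tabulate _ a) ([]=⇒lookup ιa∈S))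

  ∈-preimage⁻ : ∀ {a} → a ∈ preimage ι S → ι a ∈ S
  ∈-preimage⁻ {a} a∈ =
    lookup⇒[]= (ι a) S (trans (sym (lookup∘tabulate _ a)) ([]=⇒lookup a∈))

module _ (G' G : Graph) {S : Subset (n G)} {H : Graph}
         (ι : Fin (n G') → Fin (n G)) (ι-inj : Injective _≡_ _≡_ ι)
         (ι-cover : ∀ x → x ∈ S → ∃ λ a → ι a ≡ x)
         (ι-adj : ∀ a b → Adj G (ι a) (ι b) → Adj G' a b)
         (ι-adj⁻ : ∀ a b → ι a ∈ S → ι b ∈ S → Adj G' a b → Adj G (ι a) (ι b))
         (iso : InducedIso G S H) where
  open InducedIso iso

  private
    φ' : Fin (n H) → Fin (n G')
    φ' i = proj₁ (ι-cover (φ i) (φ-into i))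

    ι∘φ' : ∀ i → ι (φ' i) ≡ φ i
    ι∘φ' i = proj₂ (ι-cover (φ i) (φ-into i))

    φ'-into : ∀ i → ι (φ' i) ∈ S
    φ'-into i = subst (_∈ S) (sym (ι∘φ' i)) (φ-into i)

  pullback-InducedIso : InducedIso G' (preimage ι S) H
  pullback-InducedIso = record
    { φ      = φ'
    ; φ-inj  = λ {i} {j} eq →
        φ-inj (trans (sym (ι∘φ' i)) (trans (cong ι eq) (ι∘φ' j)))
    ; φ-into = λ i → ∈-preimage⁺ (φ'-into i)
    ; φ-onto = λ a a∈ → let (i , φi≡ιa) = φ-onto (ι a) (∈-preimage⁻ a∈)
                        in i , ι-inj (trans (ι∘φ' i) φi≡ιa)
    ; φ-adj  = λ i j h → ι-adj (φ' i) (φ' j)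
        (subst₂ (Adj G) (sym (ι∘φ' i)) (sym (ι∘φ' j)) (φ-adj i j h))
    ; φ-adj⁻ = λ i j e → φ-adj⁻ i j
        (subst₂ (Adj G) (ι∘φ' i) (ι∘φ' j) (ι-adj⁻ (φ' i) (φ' j) (φ'-into i) (φ'-into j) e))
    }

module _ {m} {A : Fin (suc m) → Fin (suc m) → Set}
         (s : ∀ {x y} → A x y → A y x) (irr : ∀ {x} → ¬ A x x)
         {u v : Fin (suc m)} where

  Adj⇒CAdj : ∀ a b → A (punchIn v a) (punchIn v b) → CAdj A s u v a b
  Adj⇒CAdj a b e =
    (λ { refl → irr e }) , punchIn v a , punchIn v b , inj₁ refl , inj₁ refl , e

  module _ {S : Subset (suc m)}
           (absorbed : u ∈ S → ∀ w → w ∈ S → A v w → w ≡ u ⊎ A u w) where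

    private
      Rep-Adj⇒Adj : ∀ {a b x} → a ≢ b → Rep A s u v a x → punchIn v a ∈ S → punchIn v b ∈ S
                  → A x (punchIn v b) → A (punchIn v a) (punchIn v b)
      Rep-Adj⇒Adj _   (inj₁ refl)         _   _   e = e
      Rep-Adj⇒Adj a≢b (inj₂ (a↦u , refl)) a∈S b∈S e
        with absorbed (subst (_∈ S) a↦u a∈S) _ b∈S e
      ... | inj₁ b↦u = ⊥-elim (a≢b (punchIn-injective v _ _ (trans a↦u (sym b↦u))))
      ... | inj₂ ue  = subst (λ z → A z _) (sym a↦u) ue

    CAdj⇒Adj : ∀ a b → punchIn v a ∈ S → punchIn v b ∈ S
             → CAdj A s u v a b → A (punchIn v a) (punchIn v b)
    CAdj⇒Adj a b a∈S b∈S (a≢b , _ , _ , rx , inj₁ refl , e) = Rep-Adj⇒Adj a≢b rx a∈S b∈S e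
    CAdj⇒Adj a b a∈S b∈S (a≢b , _ , _ , inj₁ refl , ry@(inj₂ _) , e) =
      s (Rep-Adj⇒Adj (≢-sym a≢b) ry b∈S a∈S (s e))
    CAdj⇒Adj a b a∈S b∈S (_ , _ , _ , inj₂ (_ , refl) , inj₂ (_ , refl) , e) = ⊥-elim (irr e)

contract-preserves-InducedIso :
  (G : Graph) (u v : Fin (n G)) (e : Adj G u v) {S : Subset (n G)} {H : Graph} →
  v ∉ S → (u ∈ S → ∀ w → w ∈ S → Adj G v w → InClosedNbhd G u w) →
  InducedIso G S H → Σ (Subset (n (contract G u v e))) λ S' → InducedIso (contract G u v e) S' H
contract-preserves-InducedIso G@record { n = suc _ ; adj-sym = s ; adj-irrefl = irr } u v e {S} v∉S absorbed iso =
  _ , pullback-InducedIso (contract G u v e) G (punchIn v) (punchIn-injective v _ _) cover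
        (Adj⇒CAdj s irr) (CAdj⇒Adj s irr absorbed) iso
  where
  cover : ∀ x → x ∈ S → ∃ λ a → punchIn v a ≡ x
  cover x x∈S = punchOut v≢x , punchIn-punchOut v≢x
    where
    v≢x : v ≢ x
    v≢x refl = v∉S x∈S

contract-preserves-HExist :
  {𝓗 : GraphClass} (G : Graph) (u v : Fin (n G)) (e : Adj G u v) {S : Subset (n G)} →
  v ∉ S → (u ∈ S → ∀ w → w ∈ S → Adj G v w → InClosedNbhd G u w) →
  InducesMember 𝓗 G S → HExist 𝓗 (contract G u v e)
contract-preserves-HExist G u v e v∉S absorbed (H , H∈𝓗 , iso) =
  let (S' , iso') = contract-preserves-InducedIso G u v e v∉S absorbed iso
  in S' , H , H∈𝓗 , iso'

theorem11 : (𝓗 : GraphClass) (G : Graph) → CriticallyHExist 𝓗 G →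
    ∀ S → InducesMember 𝓗 G S →
      (∀ x y → x ∉ S → y ∉ S → ¬ Adj G x y)
      × (∀ x y → x ∉ S → y ∈ S →
           ¬ (∀ z → InClosedNbhd G x z → InClosedNbhd G y z))
theorem11 𝓗 G (_ , contractions-free) S member = outside-independent , no-dominated-vertex
  where
  outside-independent : ∀ x y → x ∉ S → y ∉ S → ¬ Adj G x y
  outside-independent x y x∉S y∉S e = contractions-free x y e
    (contract-preserves-HExist G x y e y∉S (λ x∈S → ⊥-elim (x∉S x∈S)) member)

  no-dominated-vertex : ∀ x y → x ∉ S → y ∈ S →
    ¬ (∀ z → InClosedNbhd G x z → InClosedNbhd G y z)
  no-dominated-vertex x y x∉S y∈S N[x]⊆N[y] with N[x]⊆N[y] x (inj₁ refl)
  ... | inj₁ refl = x∉S y∈S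
  ... | inj₂ e    = contractions-free y x e
    (contract-preserves-HExist G y x e x∉S (λ _ w _ xw → N[x]⊆N[y] w (inj₂ xw)) member)
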